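{- The class $\mathcal{C}^{sp}_{\bowtie}$ of all finite special bowtie-free graphs has the free amalgamation property: if $A,B_1,B_2\in\mathcal{C}^{sp}_{\bowtie}$ with $A$ an induced subgraph of both $B_1$ and $B_2$, then the free amalgam $C$ of $B_1$ and $B_2$ over $A$ (the graph on $B_1\cup B_2$ with $B_1\cap B_2=A$, whose edges are exactly the edges of $B_1$ together with the edges of $B_2$) belongs to $\mathcal{C}^{sp}_{\bowtie}$.
   Context: Graphs are simple and undirected. A bowtie is the graph obtained from two triangles by identifying one vertex of each; a graph is bowtie-free if it has no (not necessarily induced) subgraph isomorphic to the bowtie. A chimney is the free amalgam of two or more triangles over one common edge (i.e. an edge $\{a,b\}$ together with $h\ge 2$ further vertices each adjacent to exactly $a$ and $b$ within the chimney). A bowtie-free graph is special if every vertex lies in a subgraph isomorphic to $K_4$ or in a subgraph isomorphic to a chimney. -}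

module Defs where

open import Data.Nat using (ℕ; zero; suc; _≤_)
open import Data.Fin using (Fin; zero; suc)
open import Data.Bool using (Bool; true; false)
open import Data.Product using (Σ; ∃; _×_; _,_)
open import Data.Sum using (_⊎_)
open import Relation.Binary.PropositionalEquality using (_≡_)
open import Relation.Nullary using (¬_)
open import Function.Definitions using (Injective)

record Graph : Set where
  field
    n      : ℕ
    adj    : Fin n → Fin n → Bool
    sym    : ∀ x y → adj x y ≡ adj y x
    irrefl : ∀ x → adj x x ≡ false
open Graph public

V : Graph → Set
V G = Fin (n G)

Edge : (G : Graph) → V G → V G → Set
Edge G x y = adj G x y ≡ true

record SubEmb (H G : Graph) : Set where
  field
    map  : V H → V G
    inj  : Injective _≡_ _≡_ map
    pres : ∀ x y → Edge H x y → Edge G (map x) (map y)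
open SubEmb public

-- H is isomorphic to a (not necessarily induced) subgraph of G.
HasSubgraph : Graph → Graph → Set
HasSubgraph H G = SubEmb H G

LiesIn : (G : Graph) → V G → Graph → Set
LiesIn G v H = Σ (SubEmb H G) λ f → ∃ λ i → map f i ≡ v

record IndEmb (H G : Graph) : Set where
  field
    imap  : V H → V G
    iinj  : Injective _≡_ _≡_ imap
    ipres : ∀ x y → adj G (imap x) (imap y) ≡ adj H x y
open IndEmb public

Kadj : ∀ {k} → Fin k → Fin k → Bool
Kadj zero    zero    = false
Kadj zero    (suc _) = true
Kadj (suc _) zero    = true
Kadj (suc i) (suc j) = Kadj i j

Kadj-sym : ∀ {k} (x y : Fin k) → Kadj x y ≡ Kadj y x
Kadj-sym zero zero = _≡_.refl
Kadj-sym zero (suc _) = _≡_.refl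
Kadj-sym (suc _) zero = _≡_.refl
Kadj-sym (suc i) (suc j) = Kadj-sym i j

Kadj-irr : ∀ {k} (x : Fin k) → Kadj x x ≡ false
Kadj-irr zero = _≡_.refl
Kadj-irr (suc i) = Kadj-irr i

K : ℕ → Graph
K k = record { n = k ; adj = Kadj ; sym = Kadj-sym ; irrefl = Kadj-irr }

-- Bowtie on Fin 5: centre 0, triangles {0,1,2} and {0,3,4}.
badj : Fin 5 → Fin 5 → Bool
badj zero zero = false
badj zero (suc _) = true
badj (suc _) zero = true
badj (suc zero) (suc (suc zero)) = true
badj (suc (suc zero)) (suc zero) = true
badj (suc (suc (suc zero))) (suc (suc (suc (suc zero)))) = true
badj (suc (suc (suc (suc zero)))) (suc (suc (suc zero))) = true
badj _ _ = false

badj-sym : ∀ x y → badj x y ≡ badj y x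
badj-sym zero zero = _≡_.refl
badj-sym zero (suc _) = _≡_.refl
badj-sym (suc _) zero = _≡_.refl
badj-sym (suc zero) (suc zero) = _≡_.refl
badj-sym (suc zero) (suc (suc zero)) = _≡_.refl
badj-sym (suc zero) (suc (suc (suc zero))) = _≡_.refl
badj-sym (suc zero) (suc (suc (suc (suc zero)))) = _≡_.refl
badj-sym (suc (suc zero)) (suc zero) = _≡_.refl
badj-sym (suc (suc zero)) (suc (suc zero)) = _≡_.refl
badj-sym (suc (suc zero)) (suc (suc (suc zero))) = _≡_.refl
badj-sym (suc (suc zero)) (suc (suc (suc (suc zero)))) = _≡_.refl
badj-sym (suc (suc (suc zero))) (suc zero) = _≡_.refl
badj-sym (suc (suc (suc zero))) (suc (suc zero)) = _≡_.refl
badj-sym (suc (suc (suc zero))) (suc (suc (suc zero))) = _≡_.refl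
badj-sym (suc (suc (suc zero))) (suc (suc (suc (suc zero)))) = _≡_.refl
badj-sym (suc (suc (suc (suc zero)))) (suc zero) = _≡_.refl
badj-sym (suc (suc (suc (suc zero)))) (suc (suc zero)) = _≡_.refl
badj-sym (suc (suc (suc (suc zero)))) (suc (suc (suc zero))) = _≡_.refl
badj-sym (suc (suc (suc (suc zero)))) (suc (suc (suc (suc zero)))) = _≡_.refl

badj-irr : ∀ x → badj x x ≡ false
badj-irr zero = _≡_.refl
badj-irr (suc zero) = _≡_.refl
badj-irr (suc (suc zero)) = _≡_.refl
badj-irr (suc (suc (suc zero))) = _≡_.refl
badj-irr (suc (suc (suc (suc zero)))) = _≡_.refl

Bowtie : Graph
Bowtie = record { n = 5 ; adj = badj ; sym = badj-sym ; irrefl = badj-irr }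

-- Chimney with h apex vertices on Fin (2 + h): vertices 0 = a, 1 = b,
-- the rest are apexes, each adjacent to exactly a and b.
cadj : ∀ {h} → Fin (suc (suc h)) → Fin (suc (suc h)) → Bool
cadj zero zero = false
cadj zero (suc _) = true
cadj (suc _) zero = true
cadj (suc zero) (suc zero) = false
cadj (suc zero) (suc (suc _)) = true
cadj (suc (suc _)) (suc zero) = true
cadj (suc (suc _)) (suc (suc _)) = false

cadj-sym : ∀ {h} (x y : Fin (suc (suc h))) → cadj x y ≡ cadj y x
cadj-sym zero zero = _≡_.refl
cadj-sym zero (suc _) = _≡_.refl
cadj-sym (suc _) zero = _≡_.refl
cadj-sym (suc zero) (suc zero) = _≡_.refl
cadj-sym (suc zero) (suc (suc _)) = _≡_.refl
cadj-sym (suc (suc _)) (suc zero) = _≡_.refl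
cadj-sym (suc (suc _)) (suc (suc _)) = _≡_.refl

cadj-irr : ∀ {h} (x : Fin (suc (suc h))) → cadj x x ≡ false
cadj-irr zero = _≡_.refl
cadj-irr (suc zero) = _≡_.refl
cadj-irr (suc (suc _)) = _≡_.refl

Chimney : ℕ → Graph
Chimney h = record { n = suc (suc h) ; adj = cadj ; sym = cadj-sym ; irrefl = cadj-irr }

BowtieFree : Graph → Set
BowtieFree G = ¬ HasSubgraph Bowtie G

Special : Graph → Set
Special G = BowtieFree G ×
  (∀ v → LiesIn G v (K 4) ⊎ Σ ℕ (λ h → 2 ≤ h × LiesIn G v (Chimney h)))

-- Free amalgam (characterised up to isomorphism).
record IsFreeAmalgam (A B₁ B₂ C : Graph) (e₁ : IndEmb A B₁) (e₂ : IndEmb A B₂)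
                     (g₁ : IndEmb B₁ C) (g₂ : IndEmb B₂ C) : Set where
  field
    commute  : ∀ a → imap g₁ (imap e₁ a) ≡ imap g₂ (imap e₂ a)
    cover    : ∀ c → (∃ λ x → imap g₁ x ≡ c) ⊎ (∃ λ y → imap g₂ y ≡ c)
    meet     : ∀ x y → imap g₁ x ≡ imap g₂ y →
               ∃ λ a → (imap e₁ a ≡ x) × (imap e₂ a ≡ y)
    edges    : ∀ c d → Edge C c d →
               (∃ λ x → ∃ λ x' → (imap g₁ x ≡ c) × (imap g₁ x' ≡ d))
               ⊎ (∃ λ y → ∃ λ y' → (imap g₂ y ≡ c) × (imap g₂ y' ≡ d))

-- Every edge, hence every triangle, of the free amalgam C lies inside B₁ or inside B₂. A bowtie of C
-- not contained in one of them therefore has a wing x₁x₂ in B₁ and a wing y₁y₂ in B₂, with a centre z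
-- in A, and we may take x₁ ∉ B₂, y₁ ∉ B₁. Since A is special, z is a spine vertex or a tip of a diamond
-- (K₄ minus an edge) inside A. At a spine vertex z with other spine vertex q, the two diamond triangles
-- through zq offer a triangle at z avoiding any given vertex other than q; as x₂ ≠ y₂, one of them
-- differs from q and yields a bowtie inside B₁ or inside B₂. At a tip z of the spine pq, either
-- zpq avoids x₂, or x₂ ∈ {p, q} and x₂ is the centre of a bowtie of B₁ with wings {z, x₁} and the
-- other triangle on pq. Covering by K₄'s and chimneys is inherited from B₁ and B₂.
module Submission where

open import Defs hiding (sym)
open import Data.Nat using (ℕ; suc; _≤_; s≤s)
open import Data.Fin using (Fin; zero; suc; _≟_; #_)
open import Data.Fin.Properties using (any?)
open import Data.Product using (Σ; ∃; ∃₂; _×_; _,_; proj₁; proj₂)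
import Data.Product as Prod
open import Data.Sum using (_⊎_; inj₁; inj₂)
import Data.Sum as Sum
open import Data.Bool using (true)
open import Data.Unit using (⊤)
open import Data.Empty using (⊥; ⊥-elim)
open import Data.Vec using (_∷_; []; lookup)
open import Data.Vec.Relation.Unary.All using ([]; _∷_)
open import Data.Vec.Relation.Unary.AllPairs using ([]; _∷_)
open import Data.Vec.Relation.Unary.Unique.Propositional using (Unique)
open import Data.Vec.Relation.Unary.Unique.Propositional.Properties using (lookup-injective)
open import Function using (_∘_; id)
open import Relation.Binary.PropositionalEquality using (_≡_; _≢_; refl; sym; trans; cong; cong₂)
open import Relation.Nullary using (¬_; yes; no)
open import Relation.Unary using (Decidable)

Edge-sym : (G : Graph) {x y : V G} → Edge G x y → Edge G y x
Edge-sym G {x} {y} e = trans (Graph.sym G y x) e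

_∘ⁱ_ : {A B C : Graph} → IndEmb B C → IndEmb A B → IndEmb A C
g ∘ⁱ f = record
  { imap  = imap g ∘ imap f
  ; iinj  = iinj f ∘ iinj g
  ; ipres = λ x y → trans (ipres g (imap f x) (imap f y)) (ipres f x y)
  }

_∘ˢ_ : {H B C : Graph} → IndEmb B C → SubEmb H B → SubEmb H C
g ∘ˢ f = record
  { map  = imap g ∘ map f
  ; inj  = inj f ∘ iinj g
  ; pres = λ x y e → trans (ipres g (map f x) (map f y)) (pres f x y e)
  }

InImage : {B C : Graph} → IndEmb B C → V C → Set
InImage {B} g c = ∃ λ (x : V B) → imap g x ≡ c

InImage? : {B C : Graph} (g : IndEmb B C) → Decidable (InImage g)
InImage? g c = any? (λ x → imap g x ≟ c)

pullback : {H B C : Graph} (g : IndEmb B C) (f : SubEmb H C) → (∀ i → InImage g (map f i)) → SubEmb H B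
pullback {C = C} g f lift = record
  { map  = proj₁ ∘ lift
  ; inj  = λ {i} {j} e → inj f (trans (sym (proj₂ (lift i))) (trans (cong (imap g) e) (proj₂ (lift j))))
  ; pres = λ i j e → trans (sym (ipres g _ _))
                           (trans (cong₂ (adj C) (proj₂ (lift i)) (proj₂ (lift j))) (pres f i j e))
  }

InK4OrChimney : (G : Graph) → V G → Set
InK4OrChimney G v = LiesIn G v (K 4) ⊎ Σ ℕ (λ h → 2 ≤ h × LiesIn G v (Chimney h))

liesIn-along : {H B C : Graph} (g : IndEmb B C) {x : V B} → LiesIn B x H → LiesIn C (imap g x) H
liesIn-along g (f , i , fi) = g ∘ˢ f , i , cong (imap g) fi

inK4OrChimney-along : {B C : Graph} (g : IndEmb B C) {x : V B} → InK4OrChimney B x → InK4OrChimney C (imap g x)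
inK4OrChimney-along g = Sum.map (liesIn-along g) (Prod.map₂ (Prod.map₂ (liesIn-along g)))

record Triangle (G : Graph) (x y z : V G) : Set where
  constructor triangle
  field
    x≢y : x ≢ y
    x≢z : x ≢ z
    y≢z : y ≢ z
    x~y : Edge G x y
    x~z : Edge G x z
    y~z : Edge G y z

Triangle-map : {H G : Graph} (F : SubEmb H G) {i j k : V H} →
               Triangle H i j k → Triangle G (map F i) (map F j) (map F k)
Triangle-map F (triangle i≢j i≢k j≢k i~j i~k j~k) =
  triangle (i≢j ∘ inj F) (i≢k ∘ inj F) (j≢k ∘ inj F) (pres F _ _ i~j) (pres F _ _ i~k) (pres F _ _ j~k)

-- The vertex order (z, x₁, x₂, y₁, y₂) is that of Bowtie: centre z, wings {x₁, x₂} and {y₁, y₂}.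
record IsBowtie (G : Graph) (z x₁ x₂ y₁ y₂ : V G) : Set where
  constructor bowtie
  field
    left  : Triangle G z x₁ x₂
    right : Triangle G z y₁ y₂
    x₁≢y₁ : x₁ ≢ y₁
    x₁≢y₂ : x₁ ≢ y₂
    x₂≢y₁ : x₂ ≢ y₁
    x₂≢y₂ : x₂ ≢ y₂

BowtieFreeOn : (G : Graph) → (V G → Set) → Set
BowtieFreeOn G S = ∀ {z x₁ x₂ y₁ y₂} → IsBowtie G z x₁ x₂ y₁ y₂ → S z → S x₁ → S x₂ → S y₁ → S y₂ → ⊥

record Diamond (G : Graph) (p q s t : V G) : Set where
  constructor diamond
  field
    upper : Triangle G p q s
    lower : Triangle G p q t
    s≢t   : s ≢ t

DiamondIn : (G : Graph) → (V G → Set) → V G → V G → V G → V G → Set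
DiamondIn G R p q s t = Diamond G p q s t × R p × R q × R s × R t

-- z is a spine vertex (first disjunct) or a tip (second disjunct) of a diamond inside R.
DiamondAt : (G : Graph) → (V G → Set) → V G → Set
DiamondAt G R z = (∃₂ λ q s → ∃ (DiamondIn G R z q s)) ⊎ (∃₂ λ p q → ∃ (DiamondIn G R p q z))

module _ {G : Graph} where

  private
    variable
      x y z p q s t x₁ x₂ y₁ y₂ : V G

  Triangle-swap₁₂ : Triangle G x y z → Triangle G y x z
  Triangle-swap₁₂ (triangle x≢y x≢z y≢z x~y x~z y~z) =
    triangle (x≢y ∘ sym) y≢z x≢z (Edge-sym G x~y) y~z x~z

  Triangle-swap₂₃ : Triangle G x y z → Triangle G x z y
  Triangle-swap₂₃ (triangle x≢y x≢z y≢z x~y x~z y~z) =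
    triangle x≢z x≢y (y≢z ∘ sym) x~z x~y (Edge-sym G y~z)

  Triangle-rotate : Triangle G x y z → Triangle G z x y
  Triangle-rotate = Triangle-swap₁₂ ∘ Triangle-swap₂₃

  IsBowtie-swap : IsBowtie G z x₁ x₂ y₁ y₂ → IsBowtie G z y₁ y₂ x₁ x₂
  IsBowtie-swap (bowtie l r x₁≢y₁ x₁≢y₂ x₂≢y₁ x₂≢y₂) =
    bowtie r l (x₁≢y₁ ∘ sym) (x₂≢y₁ ∘ sym) (x₁≢y₂ ∘ sym) (x₂≢y₂ ∘ sym)

  IsBowtie⇒SubEmb : IsBowtie G z x₁ x₂ y₁ y₂ → SubEmb Bowtie G
  IsBowtie⇒SubEmb {z} {x₁} {x₂} {y₁} {y₂} bt = record
    { map  = lookup vs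
    ; inj  = λ {i} {j} → lookup-injective distinct i j
    ; pres = edge
    }
    where
      open IsBowtie bt
      module L = Triangle left
      module Rt = Triangle right
      vs = z ∷ x₁ ∷ x₂ ∷ y₁ ∷ y₂ ∷ []
      distinct : Unique vs
      distinct = (L.x≢y ∷ L.x≢z ∷ Rt.x≢y ∷ Rt.x≢z ∷ []) ∷ (L.y≢z ∷ x₁≢y₁ ∷ x₁≢y₂ ∷ [])
               ∷ (x₂≢y₁ ∷ x₂≢y₂ ∷ []) ∷ (Rt.y≢z ∷ []) ∷ [] ∷ []
      edge : ∀ i j → badj i j ≡ true → Edge G (lookup vs i) (lookup vs j)
      edge zero zero ()
      edge zero (suc zero) _ = L.x~y
      edge zero (suc (suc zero)) _ = L.x~z
      edge zero (suc (suc (suc zero))) _ = Rt.x~y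
      edge zero (suc (suc (suc (suc zero)))) _ = Rt.x~z
      edge (suc zero) zero _ = Edge-sym G L.x~y
      edge (suc zero) (suc zero) ()
      edge (suc zero) (suc (suc zero)) _ = L.y~z
      edge (suc zero) (suc (suc (suc zero))) ()
      edge (suc zero) (suc (suc (suc (suc zero)))) ()
      edge (suc (suc zero)) zero _ = Edge-sym G L.x~z
      edge (suc (suc zero)) (suc zero) _ = Edge-sym G L.y~z
      edge (suc (suc zero)) (suc (suc zero)) ()
      edge (suc (suc zero)) (suc (suc (suc zero))) ()
      edge (suc (suc zero)) (suc (suc (suc (suc zero)))) ()
      edge (suc (suc (suc zero))) zero _ = Edge-sym G Rt.x~y
      edge (suc (suc (suc zero))) (suc zero) ()
      edge (suc (suc (suc zero))) (suc (suc zero)) ()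
      edge (suc (suc (suc zero))) (suc (suc (suc zero))) ()
      edge (suc (suc (suc zero))) (suc (suc (suc (suc zero)))) _ = Rt.y~z
      edge (suc (suc (suc (suc zero)))) zero _ = Edge-sym G Rt.x~z
      edge (suc (suc (suc (suc zero)))) (suc zero) ()
      edge (suc (suc (suc (suc zero)))) (suc (suc zero)) ()
      edge (suc (suc (suc (suc zero)))) (suc (suc (suc zero))) _ = Edge-sym G Rt.y~z
      edge (suc (suc (suc (suc zero)))) (suc (suc (suc (suc zero)))) ()

  SubEmb⇒IsBowtie : (b : SubEmb Bowtie G) →
                    IsBowtie G (map b (# 0)) (map b (# 1)) (map b (# 2)) (map b (# 3)) (map b (# 4))
  SubEmb⇒IsBowtie b =
    bowtie (Triangle-map b (triangle (λ ()) (λ ()) (λ ()) refl refl refl))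
           (Triangle-map b (triangle (λ ()) (λ ()) (λ ()) refl refl refl))
           (apart (λ ())) (apart (λ ())) (apart (λ ())) (apart (λ ()))
    where
      apart : {i j : Fin 5} → i ≢ j → map b i ≢ map b j
      apart i≢j = i≢j ∘ inj b

  Diamond-swapSpine : Diamond G p q s t → Diamond G q p s t
  Diamond-swapSpine (diamond upper lower s≢t) = diamond (Triangle-swap₁₂ upper) (Triangle-swap₁₂ lower) s≢t

  DiamondAt-centre : {R : V G → Set} → DiamondAt G R z → R z
  DiamondAt-centre (inj₁ (_ , _ , _ , _ , Rz , _)) = Rz
  DiamondAt-centre (inj₂ (_ , _ , _ , _ , _ , _ , Rz , _)) = Rz

  module _ {P Q : V G → Set} (P? : Decidable P)
           (edge-side : ∀ {c d} → Edge G c d → (P c × P d) ⊎ (Q c × Q d)) where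

    ¬P⇒Q-edge : ∀ {c d} → ¬ P c → Edge G c d → Q c × Q d
    ¬P⇒Q-edge ¬Pc e = Sum.[ ⊥-elim ∘ ¬Pc ∘ proj₁ , id ] (edge-side e)

    triangle-side : Triangle G x y z → (P x × P y × P z) ⊎ (Q x × Q y × Q z)
    triangle-side {x} {y} {z} (triangle _ _ _ x~y x~z y~z) with P? x | P? y | P? z
    ... | yes Px | yes Py | yes Pz = inj₁ (Px , Py , Pz)
    ... | no ¬Px | _ | _ = inj₂ (proj₁ (¬P⇒Q-edge ¬Px x~y) , proj₂ (¬P⇒Q-edge ¬Px x~y) , proj₂ (¬P⇒Q-edge ¬Px x~z))
    ... | yes _ | no ¬Py | _ = inj₂ (proj₂ (¬P⇒Q-edge ¬Py y~x) , proj₁ (¬P⇒Q-edge ¬Py y~x) , proj₂ (¬P⇒Q-edge ¬Py y~z))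
      where y~x = Edge-sym G x~y
    ... | yes _ | yes _ | no ¬Pz = inj₂ (proj₂ (¬P⇒Q-edge ¬Pz z~x) , proj₂ (¬P⇒Q-edge ¬Pz z~y) , proj₁ (¬P⇒Q-edge ¬Pz z~x))
      where z~x = Edge-sym G x~z
            z~y = Edge-sym G y~z

image-bowtieFree : {B C : Graph} (g : IndEmb B C) → BowtieFree B → BowtieFreeOn C (InImage g)
image-bowtieFree g bf bt Iz Ix₁ Ix₂ Iy₁ Iy₂ = bf (pullback g (IsBowtie⇒SubEmb bt) lift)
  where
    lift : ∀ i → InImage g (map (IsBowtie⇒SubEmb bt) i)
    lift zero = Iz
    lift (suc zero) = Ix₁
    lift (suc (suc zero)) = Ix₂
    lift (suc (suc (suc zero))) = Iy₁
    lift (suc (suc (suc (suc zero)))) = Iy₂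

Diamond-map : {H G : Graph} (F : SubEmb H G) {p q s t : V H} →
              Diamond H p q s t → Diamond G (map F p) (map F q) (map F s) (map F t)
Diamond-map F (diamond upper lower s≢t) = diamond (Triangle-map F upper) (Triangle-map F lower) (s≢t ∘ inj F)

DiamondAt-map : {H G : Graph} {R : V G → Set} (F : SubEmb H G) → (∀ j → R (map F j)) →
                {S : V H → Set} {i : V H} → DiamondAt H S i → DiamondAt G R (map F i)
DiamondAt-map F inR {i = i} (inj₁ (q , s , t , D , _)) =
  inj₁ (map F q , map F s , map F t , Diamond-map F D , inR i , inR q , inR s , inR t)
DiamondAt-map F inR {i = i} (inj₂ (p , q , t , D , _)) =
  inj₂ (map F p , map F q , map F t , Diamond-map F D , inR p , inR q , inR i , inR t)

K-edge : ∀ {k} {i j : Fin k} → i ≢ j → Edge (K k) i j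
K-edge {i = zero} {zero} i≢j = ⊥-elim (i≢j refl)
K-edge {i = zero} {suc _} _ = refl
K-edge {i = suc _} {zero} _ = refl
K-edge {i = suc _} {suc _} i≢j = K-edge (i≢j ∘ cong suc)

K-triangle : ∀ {k} {i j l : Fin k} → i ≢ j → i ≢ l → j ≢ l → Triangle (K k) i j l
K-triangle i≢j i≢l j≢l = triangle i≢j i≢l j≢l (K-edge i≢j) (K-edge i≢l) (K-edge j≢l)

K-diamond : ∀ {k} {p q s t : Fin k} → p ≢ q → p ≢ s → p ≢ t → q ≢ s → q ≢ t → s ≢ t → Diamond (K k) p q s t
K-diamond p≢q p≢s p≢t q≢s q≢t s≢t = diamond (K-triangle p≢q p≢s q≢s) (K-triangle p≢q p≢t q≢t) s≢t

K4-diamondAt : ∀ i → DiamondAt (K 4) (λ _ → ⊤) i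
K4-diamondAt zero = inj₁ (# 1 , # 2 , # 3 , K-diamond (λ ()) (λ ()) (λ ()) (λ ()) (λ ()) (λ ()) , _)
K4-diamondAt (suc zero) = inj₁ (# 0 , # 2 , # 3 , K-diamond (λ ()) (λ ()) (λ ()) (λ ()) (λ ()) (λ ()) , _)
K4-diamondAt (suc (suc zero)) = inj₁ (# 0 , # 1 , # 3 , K-diamond (λ ()) (λ ()) (λ ()) (λ ()) (λ ()) (λ ()) , _)
K4-diamondAt (suc (suc (suc zero))) = inj₁ (# 0 , # 1 , # 2 , K-diamond (λ ()) (λ ()) (λ ()) (λ ()) (λ ()) (λ ()) , _)

chimney-triangle : ∀ {h} (k : Fin h) → Triangle (Chimney h) zero (suc zero) (suc (suc k))
chimney-triangle _ = triangle (λ ()) (λ ()) (λ ()) refl refl refl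

chimney-spine-diamond : ∀ {h} → Diamond (Chimney (suc (suc h))) zero (suc zero) (# 2) (# 3)
chimney-spine-diamond = diamond (chimney-triangle zero) (chimney-triangle (suc zero)) (λ ())

chimney-diamondAt : ∀ {h} i → DiamondAt (Chimney (suc (suc h))) (λ _ → ⊤) i
chimney-diamondAt zero = inj₁ (# 1 , # 2 , # 3 , chimney-spine-diamond , _)
chimney-diamondAt (suc zero) = inj₁ (# 0 , # 2 , # 3 , Diamond-swapSpine chimney-spine-diamond , _)
chimney-diamondAt (suc (suc zero)) = inj₂ (# 0 , # 1 , # 3 , chimney-spine-diamond , _)
chimney-diamondAt (suc (suc (suc k))) =
  inj₂ (# 0 , # 1 , # 2 , diamond (chimney-triangle (suc k)) (chimney-triangle zero) (λ ()) , _)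

diamondAt-image : {A G : Graph} (g : IndEmb A G) {a : V A} → InK4OrChimney A a → DiamondAt G (InImage g) (imap g a)
diamondAt-image g (inj₁ (f , i , refl)) =
  DiamondAt-map (g ∘ˢ f) (λ j → map f j , refl) (K4-diamondAt i)
diamondAt-image g (inj₂ (suc (suc h) , s≤s (s≤s _) , f , i , refl)) =
  DiamondAt-map (g ∘ˢ f) (λ j → map f j , refl) (chimney-diamondAt i)

module OneSide {G : Graph} {S R : V G → Set} (R⊆S : ∀ {v} → R v → S v) (S-free : BowtieFreeOn G S) where

  private
    variable
      z p q s t u w x₁ x₂ : V G

  ∉⇒≢ : {x y : V G} → ¬ R x → R y → x ≢ y
  ∉⇒≢ ¬Rx Ry refl = ¬Rx Ry

  avoided : Triangle G z x₁ x₂ → S z → S x₁ → S x₂ → ¬ R x₁ →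
            Triangle G z u w → R u → R w → x₂ ≢ u → x₂ ≢ w → ⊥
  avoided tx Sz Sx₁ Sx₂ ¬Rx₁ tuw Ru Rw x₂≢u x₂≢w =
    S-free (bowtie tx tuw (∉⇒≢ ¬Rx₁ Ru) (∉⇒≢ ¬Rx₁ Rw) x₂≢u x₂≢w) Sz Sx₁ Sx₂ (R⊆S Ru) (R⊆S Rw)

  spine : DiamondIn G R z q s t → Triangle G z x₁ x₂ → S x₁ → S x₂ → ¬ R x₁ → x₂ ≢ q → ⊥
  spine {s = s} {x₂ = x₂} (diamond upper lower s≢t , Rz , Rq , Rs , Rt) tx Sx₁ Sx₂ ¬Rx₁ x₂≢q with x₂ ≟ s
  ... | yes refl = avoided tx (R⊆S Rz) Sx₁ Sx₂ ¬Rx₁ lower Rq Rt x₂≢q s≢t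
  ... | no x₂≢s  = avoided tx (R⊆S Rz) Sx₁ Sx₂ ¬Rx₁ upper Rq Rs x₂≢q x₂≢s

  -- The bowtie is centred at p, not at z: its wings are {z, x₁} and {q, t}.
  tip-centred : DiamondIn G R p q z t → Triangle G z x₁ p → S x₁ → ¬ R x₁ → ⊥
  tip-centred (diamond upper lower s≢t , Rp , Rq , Rz , Rt) tx Sx₁ ¬Rx₁ =
    S-free (bowtie (Triangle-rotate tx) lower (Triangle.y≢z upper ∘ sym) s≢t (∉⇒≢ ¬Rx₁ Rq) (∉⇒≢ ¬Rx₁ Rt))
           (R⊆S Rp) (R⊆S Rz) Sx₁ (R⊆S Rq) (R⊆S Rt)

  tip : DiamondIn G R p q z t → Triangle G z x₁ x₂ → S x₁ → S x₂ → ¬ R x₁ → ⊥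
  tip {p = p} {q = q} {x₂ = x₂} D@(pqzt , Rp , Rq , Rz , Rt) tx Sx₁ Sx₂ ¬Rx₁ with x₂ ≟ p | x₂ ≟ q
  ... | yes refl | _ = tip-centred D tx Sx₁ ¬Rx₁
  ... | _ | yes refl = tip-centred (Diamond-swapSpine pqzt , Rq , Rp , Rz , Rt) tx Sx₁ ¬Rx₁
  ... | no x₂≢p | no x₂≢q =
    avoided tx (R⊆S Rz) Sx₁ Sx₂ ¬Rx₁ (Triangle-rotate (Diamond.upper pqzt)) Rp Rq x₂≢p x₂≢q

module Straddling {G : Graph} {P Q R : V G → Set} (P? : Decidable P) (Q? : Decidable Q)
                  (R⊆P : ∀ {v} → R v → P v) (R⊆Q : ∀ {v} → R v → Q v)
                  (P-free : BowtieFreeOn G P) (Q-free : BowtieFreeOn G Q) where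

  private
    module OnP = OneSide R⊆P P-free
    module OnQ = OneSide R⊆Q Q-free
    variable
      z x₁ x₂ y₁ y₂ : V G

  noStraddlingBowtie-oriented : Triangle G z x₁ x₂ → Triangle G z y₁ y₂ → x₂ ≢ y₂ →
                                P x₁ → P x₂ → ¬ Q x₁ → Q y₁ → Q y₂ → ¬ P y₁ → DiamondAt G R z → ⊥
  noStraddlingBowtie-oriented {x₂ = x₂} tx ty x₂≢y₂ Px₁ Px₂ ¬Qx₁ Qy₁ Qy₂ ¬Py₁ (inj₁ (q , _ , _ , D)) with x₂ ≟ q
  ... | no x₂≢q = OnP.spine D tx Px₁ Px₂ (¬Qx₁ ∘ R⊆Q) x₂≢q
  ... | yes refl = OnQ.spine D ty Qy₁ Qy₂ (¬Py₁ ∘ R⊆P) (x₂≢y₂ ∘ sym)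
  noStraddlingBowtie-oriented tx _ _ Px₁ Px₂ ¬Qx₁ _ _ _ (inj₂ (_ , _ , _ , D)) = OnP.tip D tx Px₁ Px₂ (¬Qx₁ ∘ R⊆Q)

  noStraddlingBowtie : IsBowtie G z x₁ x₂ y₁ y₂ → P x₁ → P x₂ → Q y₁ → Q y₂ → DiamondAt G R z → ⊥
  noStraddlingBowtie {x₁ = x₁} {x₂} {y₁} {y₂} bt@(bowtie l r x₁≢y₁ x₁≢y₂ x₂≢y₁ x₂≢y₂) Px₁ Px₂ Qy₁ Qy₂ D
    with Q? x₁ | Q? x₂ | P? y₁ | P? y₂
  ... | yes Qx₁ | yes Qx₂ | _ | _ = Q-free bt (R⊆Q (DiamondAt-centre D)) Qx₁ Qx₂ Qy₁ Qy₂
  ... | _ | _ | yes Py₁ | yes Py₂ = P-free bt (R⊆P (DiamondAt-centre D)) Px₁ Px₂ Py₁ Py₂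
  ... | no ¬Qx₁ | _ | no ¬Py₁ | _ =
    noStraddlingBowtie-oriented l r x₂≢y₂ Px₁ Px₂ ¬Qx₁ Qy₁ Qy₂ ¬Py₁ D
  ... | no ¬Qx₁ | _ | yes _ | no ¬Py₂ =
    noStraddlingBowtie-oriented l (Triangle-swap₂₃ r) x₂≢y₁ Px₁ Px₂ ¬Qx₁ Qy₂ Qy₁ ¬Py₂ D
  ... | yes _ | no ¬Qx₂ | no ¬Py₁ | _ =
    noStraddlingBowtie-oriented (Triangle-swap₂₃ l) r x₁≢y₂ Px₂ Px₁ ¬Qx₂ Qy₁ Qy₂ ¬Py₁ D
  ... | yes _ | no ¬Qx₂ | yes _ | no ¬Py₂ =
    noStraddlingBowtie-oriented (Triangle-swap₂₃ l) (Triangle-swap₂₃ r) x₁≢y₁ Px₂ Px₁ ¬Qx₂ Qy₂ Qy₁ ¬Py₂ D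

module FreeAmalgam {A B₁ B₂ C : Graph} {e₁ : IndEmb A B₁} {e₂ : IndEmb A B₂} {g₁ : IndEmb B₁ C} {g₂ : IndEmb B₂ C}
                   (amalgam : IsFreeAmalgam A B₁ B₂ C e₁ e₂ g₁ g₂) where

  open IsFreeAmalgam amalgam

  private
    In₁ In₂ InA : V C → Set
    In₁ = InImage g₁
    In₂ = InImage g₂
    InA = InImage (g₁ ∘ⁱ e₁)

    variable
      c d z x₁ x₂ y₁ y₂ : V C

  InA⇒In₁ : InA c → In₁ c
  InA⇒In₁ (a , ga) = imap e₁ a , ga

  InA⇒In₂ : InA c → In₂ c
  InA⇒In₂ (a , ga) = imap e₂ a , trans (sym (commute a)) ga

  In₁∩In₂⇒InA : In₁ c → In₂ c → InA c
  In₁∩In₂⇒InA (x , refl) (y , gy) with meet x y (sym gy)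
  ... | a , refl , _ = a , refl

  edge-side : Edge C c d → (In₁ c × In₁ d) ⊎ (In₂ c × In₂ d)
  edge-side e = Sum.map (λ (x , x' , gx , gx') → (x , gx) , (x' , gx'))
                        (λ (y , y' , gy , gy') → (y , gy) , (y' , gy'))
                        (edges _ _ e)

  bowtieFree : (∀ a → InK4OrChimney A a) → BowtieFree B₁ → BowtieFree B₂ → BowtieFree C
  bowtieFree sA bf₁ bf₂ b = noBowtie (SubEmb⇒IsBowtie b)
    where
      open Straddling (InImage? g₁) (InImage? g₂) InA⇒In₁ InA⇒In₂ (image-bowtieFree g₁ bf₁) (image-bowtieFree g₂ bf₂)

      diamond-around : In₁ z → In₂ z → DiamondAt C InA z
      diamond-around I₁z I₂z with In₁∩In₂⇒InA I₁z I₂z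
      ... | a , refl = diamondAt-image (g₁ ∘ⁱ e₁) (sA a)

      side : {x y z : V C} → Triangle C x y z → (In₁ x × In₁ y × In₁ z) ⊎ (In₂ x × In₂ y × In₂ z)
      side = triangle-side (InImage? g₁) edge-side

      noBowtie : IsBowtie C z x₁ x₂ y₁ y₂ → ⊥
      noBowtie bt@(bowtie l r _ _ _ _) with side l | side r
      ... | inj₁ (I₁z , I₁x₁ , I₁x₂) | inj₁ (_ , I₁y₁ , I₁y₂) = image-bowtieFree g₁ bf₁ bt I₁z I₁x₁ I₁x₂ I₁y₁ I₁y₂
      ... | inj₂ (I₂z , I₂x₁ , I₂x₂) | inj₂ (_ , I₂y₁ , I₂y₂) = image-bowtieFree g₂ bf₂ bt I₂z I₂x₁ I₂x₂ I₂y₁ I₂y₂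
      ... | inj₁ (I₁z , I₁x₁ , I₁x₂) | inj₂ (I₂z , I₂y₁ , I₂y₂) =
        noStraddlingBowtie bt I₁x₁ I₁x₂ I₂y₁ I₂y₂ (diamond-around I₁z I₂z)
      ... | inj₂ (I₂z , I₂x₁ , I₂x₂) | inj₁ (I₁z , I₁y₁ , I₁y₂) =
        noStraddlingBowtie (IsBowtie-swap bt) I₁y₁ I₁y₂ I₂x₁ I₂x₂ (diamond-around I₁z I₂z)

  inK4OrChimney : (∀ x → InK4OrChimney B₁ x) → (∀ y → InK4OrChimney B₂ y) → ∀ c → InK4OrChimney C c
  inK4OrChimney s₁ s₂ c with cover c
  ... | inj₁ (x , refl) = inK4OrChimney-along g₁ (s₁ x)
  ... | inj₂ (y , refl) = inK4OrChimney-along g₂ (s₂ y)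

mainTheorem3 : (A B₁ B₂ C : Graph) (e₁ : IndEmb A B₁) (e₂ : IndEmb A B₂) (g₁ : IndEmb B₁ C) (g₂ : IndEmb B₂ C) → Special A → Special B₁ → Special B₂ → IsFreeAmalgam A B₁ B₂ C e₁ e₂ g₁ g₂ → Special C
mainTheorem3 A B₁ B₂ C e₁ e₂ g₁ g₂ (_ , sA) (bf₁ , s₁) (bf₂ , s₂) amalgam =
  bowtieFree sA bf₁ bf₂ , inK4OrChimney s₁ s₂
  where open FreeAmalgam amalgam
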